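{- Let $\mathcal{T}$ be the semiregular planar tiling $(p.q.p.q)$. Then the number of perfect precise $4$-colorings of $\mathcal{T}$ is (1) one if and only if one of the following holds: $p$ and $q$ are even and $p$ or $q$ is not a multiple of $3$; or $p$ and $q$ are multiples of $3$ and $p$ or $q$ is not even; (2) two if and only if $p$ and $q$ are divisible by $6$.
   Context: A semiregular tiling $(p_1.p_2.\cdots.p_k)$ of the plane (spherical, Euclidean or hyperbolic) is an edge-to-edge tiling by regular polygons in which around every vertex there occur a $p_1$-gon, ..., a $p_k$-gon in this cyclic order or in reverse; it is $k$-valent. An $n$-coloring is a surjective map from the set of tiles to a set of $n$ colors. For a $k$-valent tiling, a $k$-coloring is precise if all $k$ colors appear at every vertex. A coloring is perfect if every element of the symmetry group $G$ of the uncolored tiling permutes the colors (maps each color class onto a color class). Colorings are counted as partitions of the tiles into color classes, up to the action of the symmetry group of the tiling. -}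

module Defs where

open import Data.Nat using (ℕ; zero; suc; _≤_)
open import Data.Nat.Divisibility using (_∣_)
open import Data.Fin using (Fin; zero; suc)
open import Data.List using (List; []; _∷_; _++_; map)
open import Data.List.Membership.Propositional using (_∈_)
open import Data.Product using (Σ; ∃; _×_; _,_)
open import Data.Sum using (_⊎_)
open import Relation.Nullary using (¬_)
open import Relation.Binary.PropositionalEquality using (_≡_)
open import Function.Bundles using (_⇔_)

-- Combinatorial model of the semiregular tiling (p.q.p.q).
-- (p.q.p.q) is the medial (rectification) of the regular tiling {p,q}:
-- its p-gon tiles are the faces of {p,q} and its q-gon tiles are the
-- vertices of {p,q}; its vertices are the edges of {p,q}.
-- The symmetry group of {p,q} is the Coxeter group [p,q] with
-- generators r₀ r₁ r₂ (r₀ moves the base vertex, r₁ the base edge,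
-- r₂ the base face), presented by
--   r_i² = 1, (r₀r₁)^p = 1, (r₁r₂)^q = 1, (r₀r₂)² = 1.
-- Group elements are words over Fin 3 modulo the congruence below.

Word : Set
Word = List (Fin 3)

r₀ r₁ r₂ : Fin 3
r₀ = zero
r₁ = suc zero
r₂ = suc (suc zero)

rep : ℕ → Word → Word
rep zero    w = []
rep (suc n) w = w ++ rep n w

data Relator (p q : ℕ) : Word → Set where
  invol : (i : Fin 3) → Relator p q (i ∷ i ∷ [])
  face  : Relator p q (rep p (r₀ ∷ r₁ ∷ []))
  vert  : Relator p q (rep q (r₁ ∷ r₂ ∷ []))
  comm  : Relator p q (rep 2 (r₀ ∷ r₂ ∷ []))

data WordEq (p q : ℕ) : Word → Word → Set where
  wrel   : (u v l : Word) → Relator p q l → WordEq p q (u ++ l ++ v) (u ++ v)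
  wrefl  : (u : Word) → WordEq p q u u
  wsym   : {u v : Word} → WordEq p q u v → WordEq p q v u
  wtrans : {u v w : Word} → WordEq p q u v → WordEq p q v w → WordEq p q u w

data Kind : Set where
  qgon pgon : Kind

flipKind : Kind → Kind
flipKind qgon = pgon
flipKind pgon = qgon

StabGen : Kind → Fin 3 → Set
StabGen qgon i = (i ≡ r₁) ⊎ (i ≡ r₂)
StabGen pgon i = (i ≡ r₀) ⊎ (i ≡ r₁)

data AllStab (k : Kind) : Word → Set where
  []  : AllStab k []
  _∷_ : {i : Fin 3} {w : Word} → StabGen k i → AllStab k w → AllStab k (i ∷ w)

-- a tile is a coset  w · Stab(k)
record Tile : Set where
  constructor tile
  field
    kind : Kind
    word : Word
open Tile public

TileEq : (p q : ℕ) → Tile → Tile → Set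
TileEq p q (tile k w) (tile k' w') =
  (k ≡ k') × Σ Word (λ s → AllStab k s × WordEq p q w' (w ++ s))

-- The four tiles around the vertex of (p.q.p.q) corresponding to the
-- edge  w·e  of {p,q}: the two q-gons (endpoints w·v, w r₀·v) and the
-- two p-gons (faces w·f, w r₂·f).
tilesAt : Word → List Tile
tilesAt w = tile qgon w ∷ tile qgon (w ++ r₀ ∷ [])
          ∷ tile pgon w ∷ tile pgon (w ++ r₂ ∷ []) ∷ []

-- Symmetry group of (p.q.p.q): [p,q] acting on the left, together with
-- (only when p = q) the duality d (d r₀ d = r₂, d r₁ d = r₁) which swaps
-- the two kinds of tiles; then the group is [p,4] ⊇ [p,p].
swapLetter : Fin 3 → Fin 3
swapLetter zero = suc (suc zero)
swapLetter (suc zero) = suc zero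
swapLetter (suc (suc zero)) = zero

data Sym (p q : ℕ) : Set where
  rot  : Word → Sym p q
  dual : p ≡ q → Word → Sym p q

act : {p q : ℕ} → Sym p q → Tile → Tile
act (rot g)    (tile k w) = tile k (g ++ w)
act (dual _ g) (tile k w) = tile (flipKind k) (g ++ map swapLetter w)

record Coloring (p q n : ℕ) : Set where
  field
    col  : Tile → Fin n
    resp : ∀ {t t'} → TileEq p q t t' → col t ≡ col t'
    surj : (c : Fin n) → ∃ λ t → col t ≡ c
open Coloring public

Precise : {p q : ℕ} → Coloring p q 4 → Set
Precise c = (w : Word) (x : Fin 4) → x ∈ map (col c) (tilesAt w)

Perfect : {p q n : ℕ} → Coloring p q n → Set
Perfect {p} {q} c = (g : Sym p q) (t t' : Tile) →
  (col c t ≡ col c t') ⇔ (col c (act g t) ≡ col c (act g t'))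

Equiv : {p q n : ℕ} → Coloring p q n → Coloring p q n → Set
Equiv {p} {q} c c' = Σ (Sym p q) λ g → (t t' : Tile) →
  (col c t ≡ col c t') ⇔ (col c' (act g t) ≡ col c' (act g t'))

PerfectPrecise : (p q : ℕ) → Coloring p q 4 → Set
PerfectPrecise p q c = Perfect c × Precise c

NumPerfectPrecise : (p q m : ℕ) → Set
NumPerfectPrecise p q m =
  Σ (Fin m → Coloring p q 4) λ cs →
    ((i : Fin m) → PerfectPrecise p q (cs i))
  × ((i j : Fin m) → Equiv (cs i) (cs j) → i ≡ j)
  × ((c : Coloring p q 4) → PerfectPrecise p q c → ∃ λ i → Equiv c (cs i))

-- A perfect colouring turns every symmetry into a permutation of the colours; a precise
-- one shows all four colours at the base vertex, so it is the pullback of the action of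
-- [p,q] on the colours of the four tiles there. In that action r₀ swaps the two q-gons,
-- r₂ the two p-gons, and r₁, fixing the base q-gon and p-gon, either fixes (untwisted) or
-- swaps (twisted) the other two. Then r₀r₁ and r₁r₂ act with order 2 resp. 3, so the
-- relators of [p,q] admit the twist iff that order divides p and q, and the action is then
-- a perfect precise colouring. Every symmetry, the duality included, preserves the colour
-- classes of both model colourings, and these classes differ; hence perfect precise
-- colourings up to symmetry correspond to the admissible twists.
module Submission where

open import Defs
open import Data.Nat using (ℕ; zero; suc; _+_; _*_; _≤_; _<_; s≤s; NonZero)
open import Data.Nat.DivMod using (_%_; _/_; m≡m%n+[m/n]*n; m%n<n)
open import Data.Nat.Divisibility using (_∣_; divides; _∣?_; ∣-trans; m%n≡0⇒n∣m)
open import Data.Nat.GeneralisedArithmetic using (fold; fold-+)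
open import Data.Nat.LCM using (lcm-least)
open import Data.Nat.Properties using (1+n≰n)
open import Data.Fin using (Fin; punchOut; _≟_)
open import Data.Fin.Patterns using (0F; 1F; 2F; 3F)
open import Data.Fin.Properties using (punchOut-injective; injective⇒≤)
open import Data.Fin.Permutation.Components using (transpose)
open import Data.List using ([]; _∷_; _++_; map; foldr; allFin)
open import Data.List.Properties using (foldr-++; ++-identityʳ)
open import Data.List.Membership.Propositional using (_∈_)
open import Data.List.Membership.Propositional.Properties using (∈-map⁺; ∈-map⁻; ∈-allFin)
open import Data.Product using (Σ; ∃; _×_; _,_; proj₁; proj₂)
open import Data.Sum using (_⊎_; inj₁; inj₂; [_,_])
open import Data.Empty using (⊥-elim)
open import Function.Base using (_∘_; id)
open import Function.Bundles using (_⇔_; mk⇔; Equivalence)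
open import Function.Definitions using (Injective)
open import Function.Properties.Equivalence using ()
  renaming (refl to ⇔-refl; sym to ⇔-sym; trans to ⇔-trans)
open import Relation.Nullary using (¬_; Dec; yes; no; contradiction)
open import Relation.Binary.PropositionalEquality
  using (_≡_; _≢_; refl; sym; trans; cong; cong₂; subst; module ≡-Reasoning)

open ≡-Reasoning

SameKernel : {A B C : Set} → (A → B) → (A → C) → Set
SameKernel f g = ∀ a a′ → (f a ≡ f a′) ⇔ (g a ≡ g a′)

module _ {A B C : Set} {f : A → B} {g : A → C} where

  sameKernel-sym : SameKernel f g → SameKernel g f
  sameKernel-sym f~g a a′ = ⇔-sym (f~g a a′)

  sameKernel-trans : {D : Set} {h : A → D} → SameKernel f g → SameKernel g h → SameKernel f h
  sameKernel-trans f~g g~h a a′ = ⇔-trans (f~g a a′) (g~h a a′)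

  sameKernel-∘ʳ : {D : Set} → SameKernel f g → (h : D → A) → SameKernel (f ∘ h) (g ∘ h)
  sameKernel-∘ʳ f~g h d d′ = f~g (h d) (h d′)

  injective-sameKernel : {φ : B → C} → Injective _≡_ _≡_ φ → (∀ a → g a ≡ φ (f a)) →
                         SameKernel f g
  injective-sameKernel {φ} φ-injective g≗φ∘f a a′ = mk⇔
    (λ fa≡fa′ → trans (g≗φ∘f a) (trans (cong φ fa≡fa′) (sym (g≗φ∘f a′))))
    (λ ga≡ga′ → φ-injective (trans (sym (g≗φ∘f a)) (trans ga≡ga′ (g≗φ∘f a′))))

-- A section g of f misses x or y when f x ≡ f y and x ≢ y; punching the missed point out
-- of the codomain of g gives an injection Fin (suc n) → Fin n.
endo-surjective⇒injective : ∀ {n} (f : Fin n → Fin n) → (∀ y → ∃ λ x → f x ≡ y) →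
                            Injective _≡_ _≡_ f
endo-surjective⇒injective {zero} f surjective {()}
endo-surjective⇒injective {suc n} f surjective {x} {y} fx≡fy with x ≟ y
... | yes x≡y = x≡y
... | no x≢y = contradiction (injective⇒≤ punched-injective) 1+n≰n
  where
  g : Fin (suc n) → Fin (suc n)
  g = proj₁ ∘ surjective

  f∘g : ∀ z → f (g z) ≡ z
  f∘g = proj₂ ∘ surjective

  g-injective : Injective _≡_ _≡_ g
  g-injective {a} {b} ga≡gb = trans (sym (f∘g a)) (trans (cong f ga≡gb) (f∘g b))

  missed : ∀ m → g (f m) ≢ m → ∀ a → g a ≢ m
  missed m gfm≢m a ga≡m = gfm≢m (trans (cong g (trans (cong f (sym ga≡m)) (f∘g a))) ga≡m)

  unreached : ∃ λ m → ∀ a → g a ≢ m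
  unreached with g (f x) ≟ x
  ... | no gfx≢x = x , missed x gfx≢x
  ... | yes gfx≡x = y , missed y (λ gfy≡y → x≢y (trans (sym gfx≡x) (trans (cong g fx≡fy) gfy≡y)))

  m≢g : ∀ a → proj₁ unreached ≢ g a
  m≢g a = proj₂ unreached a ∘ sym

  punched : Fin (suc n) → Fin n
  punched a = punchOut (m≢g a)

  punched-injective : Injective _≡_ _≡_ punched
  punched-injective {a} {b} = g-injective ∘ punchOut-injective (m≢g a) (m≢g b)

module _ {A : Set} (h : A → A) {k : ℕ} (hᵏ≗id : ∀ x → fold x h k ≡ x) where

  fold-*-periodic : ∀ m x → fold x h (m * k) ≡ x
  fold-*-periodic zero    x = refl
  fold-*-periodic (suc m) x = begin
    fold x h (k + m * k)          ≡⟨ fold-+ x h k ⟩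
    fold (fold x h (m * k)) h k   ≡⟨ hᵏ≗id _ ⟩
    fold x h (m * k)              ≡⟨ fold-*-periodic m x ⟩
    x                             ∎

  ∣⇒fold-id : ∀ {n} → k ∣ n → ∀ x → fold x h n ≡ x
  ∣⇒fold-id (divides m refl) = fold-*-periodic m

  fold-id⇒∣ : .{{_ : NonZero k}} → ∀ {x n} → (∀ j → suc j < k → fold x h (suc j) ≢ x) →
              fold x h n ≡ x → k ∣ n
  fold-id⇒∣ {x} {n} x-moves hⁿx≡x = m%n≡0⇒n∣m n k (remainder-zero (n % k) (m%n<n n k) hʳx≡x)
    where
    hʳx≡x : fold x h (n % k) ≡ x
    hʳx≡x = begin
      fold x h (n % k)
        ≡⟨ cong (λ y → fold y h (n % k)) (fold-*-periodic (n / k) x) ⟨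
      fold (fold x h (n / k * k)) h (n % k)   ≡⟨ fold-+ x h (n % k) ⟨
      fold x h (n % k + n / k * k)            ≡⟨ cong (fold x h) (m≡m%n+[m/n]*n n k) ⟨
      fold x h n                              ≡⟨ hⁿx≡x ⟩
      x                                       ∎

    remainder-zero : ∀ r → r < k → fold x h r ≡ x → r ≡ 0
    remainder-zero zero    _   _     = refl
    remainder-zero (suc r) r<k hʳx≡x = contradiction hʳx≡x (x-moves r r<k)

module WordAction {A : Set} (gen : Fin 3 → A → A) (gen-involutive : ∀ i x → gen i (gen i x) ≡ x)
  where

  infixr 6 _·_
  _·_ : Word → A → A
  w · x = foldr gen x w

  ·-++ : ∀ u v x → (u ++ v) · x ≡ u · v · x
  ·-++ u v x = foldr-++ gen x u v

  ·-rep : ∀ a b n x → rep n (a ∷ b ∷ []) · x ≡ fold x (gen a ∘ gen b) n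
  ·-rep a b zero    x = refl
  ·-rep a b (suc n) x = cong (gen a ∘ gen b) (·-rep a b n x)

  ·-injective : ∀ w → Injective _≡_ _≡_ (w ·_)
  ·-injective []      wx≡wy = wx≡wy
  ·-injective (i ∷ w) wx≡wy =
    ·-injective w (trans (sym (gen-involutive i _)) (trans (cong (gen i) wx≡wy) (gen-involutive i _)))

  ·-surjective : ∀ w y → ∃ λ x → w · x ≡ y
  ·-surjective []      y = y , refl
  ·-surjective (i ∷ w) y with ·-surjective w (gen i y)
  ... | x , w·x≡ = x , trans (cong (gen i) w·x≡) (gen-involutive i y)

  module _ {p q : ℕ} (relator-trivial : ∀ {l} → Relator p q l → ∀ x → l · x ≡ x) where

    ·-resp-WordEq : ∀ {u v} → WordEq p q u v → ∀ x → u · x ≡ v · x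
    ·-resp-WordEq (wrel u v l r) x = begin
      (u ++ l ++ v) · x   ≡⟨ ·-++ u (l ++ v) x ⟩
      u · (l ++ v) · x    ≡⟨ cong (u ·_) (·-++ l v x) ⟩
      u · l · v · x       ≡⟨ cong (u ·_) (relator-trivial r (v · x)) ⟩
      u · v · x           ≡⟨ ·-++ u v x ⟨
      (u ++ v) · x        ∎
    ·-resp-WordEq (wrefl u)     x = refl
    ·-resp-WordEq (wsym e)      x = sym (·-resp-WordEq e x)
    ·-resp-WordEq (wtrans e e′) x = trans (·-resp-WordEq e x) (·-resp-WordEq e′ x)

by-cases₄ : {P : Fin 4 → Set} → P 0F → P 1F → P 2F → P 3F → ∀ x → P x
by-cases₄ p₀ p₁ p₂ p₃ 0F = p₀
by-cases₄ p₀ p₁ p₂ p₃ 1F = p₁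
by-cases₄ p₀ p₁ p₂ p₃ 2F = p₂
by-cases₄ p₀ p₁ p₂ p₃ 3F = p₃

data Twist : Set where
  untwisted twisted : Twist

period : Twist → ℕ
period untwisted = 2
period twisted   = 3

Realisable : Twist → ℕ → ℕ → Set
Realisable t p q = period t ∣ p × period t ∣ q

-- The label y stands for the tile  corner y  at the base vertex, and  gen t i  is the
-- permutation of these four tiles' colours induced by r_i.
corner : Fin 4 → Tile
corner 0F = tile qgon []
corner 1F = tile qgon (r₀ ∷ [])
corner 2F = tile pgon []
corner 3F = tile pgon (r₂ ∷ [])

base : Kind → Fin 4
base qgon = 0F
base pgon = 2F

gen : Twist → Fin 3 → Fin 4 → Fin 4
gen t         0F = transpose 0F 1F
gen t         2F = transpose 2F 3F
gen untwisted 1F = id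
gen twisted   1F = transpose 1F 3F

gen-involutive : ∀ t i x → gen t i (gen t i x) ≡ x
gen-involutive t         0F = by-cases₄ refl refl refl refl
gen-involutive untwisted 1F = by-cases₄ refl refl refl refl
gen-involutive twisted   1F = by-cases₄ refl refl refl refl
gen-involutive t         2F = by-cases₄ refl refl refl refl

gen-fixes-base : ∀ t {k i} → StabGen k i → gen t i (base k) ≡ base k
gen-fixes-base untwisted {qgon} (inj₁ refl) = refl
gen-fixes-base twisted   {qgon} (inj₁ refl) = refl
gen-fixes-base t         {qgon} (inj₂ refl) = refl
gen-fixes-base t         {pgon} (inj₁ refl) = refl
gen-fixes-base untwisted {pgon} (inj₂ refl) = refl
gen-fixes-base twisted   {pgon} (inj₂ refl) = refl

swapLabel : Fin 4 → Fin 4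
swapLabel = transpose 0F 2F ∘ transpose 1F 3F

swapLabel-involutive : ∀ x → swapLabel (swapLabel x) ≡ x
swapLabel-involutive = by-cases₄ refl refl refl refl

base-flipKind : ∀ k → base (flipKind k) ≡ swapLabel (base k)
base-flipKind qgon = refl
base-flipKind pgon = refl

gen-swapLetter : ∀ t i x → gen t (swapLetter i) (swapLabel x) ≡ swapLabel (gen t i x)
gen-swapLetter t         0F = by-cases₄ refl refl refl refl
gen-swapLetter untwisted 1F = by-cases₄ refl refl refl refl
gen-swapLetter twisted   1F = by-cases₄ refl refl refl refl
gen-swapLetter t         2F = by-cases₄ refl refl refl refl

faceRotation vertexRotation : Twist → Fin 4 → Fin 4
faceRotation   t = gen t r₀ ∘ gen t r₁
vertexRotation t = gen t r₁ ∘ gen t r₂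

faceRotation-period : ∀ t x → fold x (faceRotation t) (period t) ≡ x
faceRotation-period untwisted = by-cases₄ refl refl refl refl
faceRotation-period twisted   = by-cases₄ refl refl refl refl

vertexRotation-period : ∀ t x → fold x (vertexRotation t) (period t) ≡ x
vertexRotation-period untwisted = by-cases₄ refl refl refl refl
vertexRotation-period twisted   = by-cases₄ refl refl refl refl

faceRotation-orbit : ∀ t {n} → fold 0F (faceRotation t) n ≡ 0F → period t ∣ n
faceRotation-orbit untwisted = fold-id⇒∣ _ (faceRotation-period untwisted)
  λ { zero _ () ; (suc _) (s≤s (s≤s ())) }
faceRotation-orbit twisted   = fold-id⇒∣ _ (faceRotation-period twisted)
  λ { zero _ () ; 1 _ () ; (suc (suc _)) (s≤s (s≤s (s≤s ()))) }

vertexRotation-orbit : ∀ t {n} → fold 2F (vertexRotation t) n ≡ 2F → period t ∣ n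
vertexRotation-orbit untwisted = fold-id⇒∣ _ (vertexRotation-period untwisted)
  λ { zero _ () ; (suc _) (s≤s (s≤s ())) }
vertexRotation-orbit twisted   = fold-id⇒∣ _ (vertexRotation-period twisted)
  λ { zero _ () ; 1 _ () ; (suc (suc _)) (s≤s (s≤s (s≤s ()))) }

module _ (t : Twist) where
  open WordAction (gen t) (gen-involutive t)

  label : Tile → Fin 4
  label (tile k w) = w · base k

  label-corner : ∀ y → label (corner y) ≡ y
  label-corner = by-cases₄ refl refl refl refl

  ·-fixes-base : ∀ {k s} → AllStab k s → s · base k ≡ base k
  ·-fixes-base []                 = refl
  ·-fixes-base (_∷_ {i} i-stab s-stab) =
    trans (cong (gen t i) (·-fixes-base s-stab)) (gen-fixes-base t i-stab)

  ·-swapLetter : ∀ w x → map swapLetter w · swapLabel x ≡ swapLabel (w · x)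
  ·-swapLetter []      x = refl
  ·-swapLetter (i ∷ w) x =
    trans (cong (gen t (swapLetter i)) (·-swapLetter w x)) (gen-swapLetter t i (w · x))

  label-invariant : ∀ {p q} (g : Sym p q) → SameKernel label (label ∘ act g)
  label-invariant (rot u) = injective-sameKernel (·-injective u) λ { (tile k w) → ·-++ u w (base k) }
  label-invariant (dual _ u) = injective-sameKernel swapped-injective λ { (tile k w) → begin
      (u ++ map swapLetter w) · base (flipKind k)  ≡⟨ ·-++ u (map swapLetter w) _ ⟩
      u · map swapLetter w · base (flipKind k)
        ≡⟨ cong (λ x → u · map swapLetter w · x) (base-flipKind k) ⟩
      u · map swapLetter w · swapLabel (base k)    ≡⟨ cong (u ·_) (·-swapLetter w (base k)) ⟩
      u · swapLabel (w · base k)                   ∎ }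
    where
    swapped-injective : Injective _≡_ _≡_ ((u ·_) ∘ swapLabel)
    swapped-injective {x} {y} e = begin
      x                         ≡⟨ swapLabel-involutive x ⟨
      swapLabel (swapLabel x)   ≡⟨ cong swapLabel (·-injective u e) ⟩
      swapLabel (swapLabel y)   ≡⟨ swapLabel-involutive y ⟩
      y                         ∎

  labels-at : ∀ w → map label (tilesAt w) ≡ map (w ·_) (allFin 4)
  labels-at w = cong₂ (λ a b → w · 0F ∷ a ∷ w · 2F ∷ b ∷ []) (·-++ w (r₀ ∷ []) 0F) (·-++ w (r₂ ∷ []) 2F)

  label-precise : ∀ w x → x ∈ map label (tilesAt w)
  label-precise w x with ·-surjective w x
  ... | y , refl = subst (w · y ∈_) (sym (labels-at w)) (∈-map⁺ (w ·_) (∈-allFin y))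

  module _ {p q : ℕ} (realisable : Realisable t p q) where

    relator-trivial : ∀ {l} → Relator p q l → ∀ x → l · x ≡ x
    relator-trivial (invol i) = gen-involutive t i
    relator-trivial face x =
      trans (·-rep r₀ r₁ p x) (∣⇒fold-id _ (faceRotation-period t) (proj₁ realisable) x)
    relator-trivial vert x =
      trans (·-rep r₁ r₂ q x) (∣⇒fold-id _ (vertexRotation-period t) (proj₂ realisable) x)
    relator-trivial comm = by-cases₄ refl refl refl refl

    label-resp : ∀ {a b} → TileEq p q a b → label a ≡ label b
    label-resp {tile k w} {tile .k w′} (refl , s , s-stab , w′≈ws) = sym (begin
      w′ · base k         ≡⟨ ·-resp-WordEq relator-trivial w′≈ws (base k) ⟩
      (w ++ s) · base k   ≡⟨ ·-++ w s (base k) ⟩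
      w · s · base k      ≡⟨ cong (w ·_) (·-fixes-base s-stab) ⟩
      w · base k          ∎)

    model : Coloring p q 4
    model = record { col = label ; resp = label-resp ; surj = λ y → corner y , label-corner y }

    model-perfectPrecise : PerfectPrecise p q model
    model-perfectPrecise = label-invariant , label-precise

record HasTwist {p q : ℕ} (c : Coloring p q 4) (t : Twist) : Set where
  constructor hasTwist
  field kernel : SameKernel (label t) (col c)

model-hasTwist : ∀ {p q} t (realisable : Realisable t p q) → HasTwist (model t realisable) t
model-hasTwist t realisable = hasTwist λ _ _ → ⇔-refl

-- r₀r₂ = r₂ (r₂r₀r₂) = r₂r₀ (r₀r₂)² = r₂r₀
r₀r₂≈r₂r₀ : ∀ {p q} → WordEq p q (r₀ ∷ r₂ ∷ []) (r₂ ∷ r₀ ∷ [])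
r₀r₂≈r₂r₀ = wtrans (wsym (wrel [] (r₀ ∷ r₂ ∷ []) _ (invol r₂)))
             (wtrans (wsym (wrel (r₂ ∷ []) (r₂ ∷ r₀ ∷ r₂ ∷ []) _ (invol r₀)))
                     (wrel (r₂ ∷ r₀ ∷ []) [] _ comm))

relator≈[] : ∀ {p q l} → Relator p q l → WordEq p q l []
relator≈[] {p} {q} {l} r = subst (λ u → WordEq p q u []) (++-identityʳ l) (wrel [] [] l r)

r₀-corner : ∀ {p q} y → TileEq p q (corner (transpose 0F 1F y)) (act (rot {p} {q} (r₀ ∷ [])) (corner y))
r₀-corner 0F = refl , [] , [] , wrefl _
r₀-corner 1F = refl , [] , [] , wrel [] [] _ (invol r₀)
r₀-corner 2F = refl , r₀ ∷ [] , inj₁ refl ∷ [] , wrefl _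
r₀-corner 3F = refl , r₀ ∷ [] , inj₁ refl ∷ [] , r₀r₂≈r₂r₀

r₂-corner : ∀ {p q} y → TileEq p q (corner (transpose 2F 3F y)) (act (rot {p} {q} (r₂ ∷ [])) (corner y))
r₂-corner 0F = refl , r₂ ∷ [] , inj₂ refl ∷ [] , wrefl _
r₂-corner 1F = refl , r₂ ∷ [] , inj₂ refl ∷ [] , wsym r₀r₂≈r₂r₀
r₂-corner 2F = refl , [] , [] , wrefl _
r₂-corner 3F = refl , [] , [] , wrel [] [] _ (invol r₂)

r₁-corner-0F : ∀ {p q} → TileEq p q (corner 0F) (act (rot {p} {q} (r₁ ∷ [])) (corner 0F))
r₁-corner-0F = refl , r₁ ∷ [] , inj₁ refl ∷ [] , wrefl _

r₁-corner-2F : ∀ {p q} → TileEq p q (corner 2F) (act (rot {p} {q} (r₁ ∷ [])) (corner 2F))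
r₁-corner-2F = refl , r₁ ∷ [] , inj₂ refl ∷ [] , wrefl _

injection-fixing-0F-2F : (π : Fin 4 → Fin 4) → Injective _≡_ _≡_ π → π 0F ≡ 0F → π 2F ≡ 2F →
                         ∃ λ t → ∀ y → π y ≡ gen t r₁ y
injection-fixing-0F-2F π π-injective π₀ π₂ with π 1F in π₁ | π 3F in π₃
... | 1F | 3F = untwisted , by-cases₄ π₀ π₁ π₂ π₃
... | 3F | 1F = twisted   , by-cases₄ π₀ π₁ π₂ π₃
... | 0F | _  = contradiction (π-injective (trans π₁ (sym π₀))) λ ()
... | 2F | _  = contradiction (π-injective (trans π₁ (sym π₂))) λ ()
... | _  | 0F = contradiction (π-injective (trans π₃ (sym π₀))) λ ()
... | _  | 2F = contradiction (π-injective (trans π₃ (sym π₂))) λ ()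
... | 1F | 1F = contradiction (π-injective (trans π₁ (sym π₃))) λ ()
... | 3F | 3F = contradiction (π-injective (trans π₁ (sym π₃))) λ ()

module Classification {p q : ℕ} (c : Coloring p q 4) (perfect : Perfect c) (precise : Precise c)
  where

  preserves : ∀ g a b → col c a ≡ col c b → col c (act g a) ≡ col c (act g b)
  preserves g a b = Equivalence.to (perfect g a b)

  reflects : ∀ g a b → col c (act g a) ≡ col c (act g b) → col c a ≡ col c b
  reflects g a b = Equivalence.from (perfect g a b)

  σ : Fin 4 → Fin 4
  σ = col c ∘ corner

  σ-surjective : ∀ x → ∃ λ y → σ y ≡ x
  σ-surjective x with ∈-map⁻ σ {xs = allFin 4} (precise [] x)
  ... | y , _ , x≡σy = y , sym x≡σy

  σ-injective : Injective _≡_ _≡_ σ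
  σ-injective = endo-surjective⇒injective σ σ-surjective

  r₁-colours : Fin 4 → Fin 4
  r₁-colours y = proj₁ (σ-surjective (col c (act (rot {p} {q} (r₁ ∷ [])) (corner y))))

  σ∘r₁-colours : ∀ y → σ (r₁-colours y) ≡ col c (act (rot {p} {q} (r₁ ∷ [])) (corner y))
  σ∘r₁-colours y = proj₂ (σ-surjective _)

  r₁-colours-injective : Injective _≡_ _≡_ r₁-colours
  r₁-colours-injective {y} {y′} e = σ-injective (reflects (rot (r₁ ∷ [])) (corner y) (corner y′)
    (trans (sym (σ∘r₁-colours y)) (trans (cong σ e) (σ∘r₁-colours y′))))

  r₁-colours-fixes : ∀ {y} → TileEq p q (corner y) (act (rot {p} {q} (r₁ ∷ [])) (corner y)) →
                     r₁-colours y ≡ y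
  r₁-colours-fixes {y} y≈r₁y = σ-injective (trans (σ∘r₁-colours y) (sym (resp c y≈r₁y)))

  twisting : ∃ λ t → ∀ y → r₁-colours y ≡ gen t r₁ y
  twisting = injection-fixing-0F-2F r₁-colours r₁-colours-injective
    (r₁-colours-fixes r₁-corner-0F) (r₁-colours-fixes r₁-corner-2F)

  twist : Twist
  twist = proj₁ twisting

  open WordAction (gen twist) (gen-involutive twist)

  generator-colours : ∀ i y → col c (act (rot {p} {q} (i ∷ [])) (corner y)) ≡ σ (gen twist i y)
  generator-colours 0F y = sym (resp c (r₀-corner y))
  generator-colours 1F y = trans (sym (σ∘r₁-colours y)) (cong σ (proj₂ twisting y))
  generator-colours 2F y = sym (resp c (r₂-corner y))

  colour-label : ∀ a → col c a ≡ σ (label twist a)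
  colour-label (tile qgon [])      = refl
  colour-label (tile pgon [])      = refl
  colour-label (tile k (i ∷ w)) =
    trans (preserves (rot (i ∷ [])) (tile k w) (corner (w · base k)) (colour-label (tile k w)))
          (generator-colours i (w · base k))

  c-hasTwist : HasTwist c twist
  c-hasTwist = hasTwist (injective-sameKernel σ-injective colour-label)

  relator-fixes-base : ∀ {l} → Relator p q l → ∀ k → l · base k ≡ base k
  relator-fixes-base {l} r k = σ-injective (begin
    σ (l · base k)       ≡⟨ colour-label (tile k l) ⟨
    col c (tile k l)     ≡⟨ resp c (refl , [] , [] , relator≈[] r) ⟨
    col c (tile k [])    ≡⟨ colour-label (tile k []) ⟩
    σ (base k)           ∎)

  realisable : Realisable twist p q
  realisable = faceRotation-orbit twist (trans (sym (·-rep r₀ r₁ p 0F)) (relator-fixes-base face qgon))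
             , vertexRotation-orbit twist (trans (sym (·-rep r₁ r₂ q 2F)) (relator-fixes-base vert pgon))

classify : ∀ {p q} (c : Coloring p q 4) → PerfectPrecise p q c →
           ∃ λ t → Realisable t p q × HasTwist c t
classify c (perfect , precise) = twist , realisable , c-hasTwist
  where open Classification c perfect precise

module _ {p q : ℕ} {c c′ : Coloring p q 4} where

  sameTwist⇒Equiv : ∀ {t} → HasTwist c t → HasTwist c′ t → Equiv c c′
  sameTwist⇒Equiv (hasTwist c~t) (hasTwist c′~t) = rot [] , sameKernel-trans (sameKernel-sym c~t) c′~t

  Equiv⇒sameKernel : ∀ {t t′} → Equiv c c′ → HasTwist c t → HasTwist c′ t′ →
                     SameKernel (label t) (label t′)
  Equiv⇒sameKernel {t} {t′} (g , c~c′∘g) (hasTwist c~t) (hasTwist c′~t′) =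
    sameKernel-trans c~t (sameKernel-trans c~c′∘g (sameKernel-trans
      (sameKernel-sym (sameKernel-∘ʳ c′~t′ (act g))) (sameKernel-sym (label-invariant t′ g))))

-- the q-gon r₂r₁r₀·v has the colour of the base p-gon only in the twisted colouring
label-kernels-differ : ¬ SameKernel (label untwisted) (label twisted)
label-kernels-differ same =
  contradiction (Equivalence.from (same (tile qgon (r₂ ∷ r₁ ∷ r₀ ∷ [])) (tile pgon [])) refl) λ ()

sameKernel⇒≡ : ∀ t t′ → SameKernel (label t) (label t′) → t ≡ t′
sameKernel⇒≡ untwisted untwisted _    = refl
sameKernel⇒≡ untwisted twisted   same = ⊥-elim (label-kernels-differ same)
sameKernel⇒≡ twisted   untwisted same = ⊥-elim (label-kernels-differ (sameKernel-sym same))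
sameKernel⇒≡ twisted   twisted   _    = refl

Equiv⇒sameTwist : ∀ {p q} {c c′ : Coloring p q 4} {t t′} →
                  Equiv c c′ → HasTwist c t → HasTwist c′ t′ → t ≡ t′
Equiv⇒sameTwist {t = t} {t′} c~c′ c~t c′~t′ = sameKernel⇒≡ t t′ (Equiv⇒sameKernel c~c′ c~t c′~t′)

RealisableTwists : ℕ → ℕ → ℕ → Set
RealisableTwists p q m =
  Σ (Fin m → Twist) λ ts → (∀ i → Realisable (ts i) p q) × Injective _≡_ _≡_ ts
                         × (∀ t → Realisable t p q → ∃ λ i → ts i ≡ t)

numPerfectPrecise⇔realisableTwists : ∀ {p q m} → NumPerfectPrecise p q m ⇔ RealisableTwists p q m
numPerfectPrecise⇔realisableTwists {p} {q} {m} = mk⇔ to from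
  where
  to : NumPerfectPrecise p q m → RealisableTwists p q m
  to (cs , perfectPrecise , distinct , complete) =
    ts , (proj₁ ∘ proj₂ ∘ classified) , ts-injective , ts-complete
    where
    classified : ∀ i → ∃ λ t → Realisable t p q × HasTwist (cs i) t
    classified i = classify (cs i) (perfectPrecise i)

    ts : Fin m → Twist
    ts = proj₁ ∘ classified

    csᵢ~tsᵢ : ∀ i → HasTwist (cs i) (ts i)
    csᵢ~tsᵢ = proj₂ ∘ proj₂ ∘ classified

    ts-injective : Injective _≡_ _≡_ ts
    ts-injective {i} {j} tsᵢ≡tsⱼ =
      distinct i j (sameTwist⇒Equiv (csᵢ~tsᵢ i) (subst (HasTwist (cs j)) (sym tsᵢ≡tsⱼ) (csᵢ~tsᵢ j)))

    ts-complete : ∀ t → Realisable t p q → ∃ λ i → ts i ≡ t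
    ts-complete t realisable with complete (model t realisable) (model-perfectPrecise t realisable)
    ... | i , model~csᵢ = i , sym (Equiv⇒sameTwist model~csᵢ (model-hasTwist t realisable) (csᵢ~tsᵢ i))

  from : RealisableTwists p q m → NumPerfectPrecise p q m
  from (ts , realisable , ts-injective , ts-complete) =
    cs , (λ i → model-perfectPrecise (ts i) (realisable i)) , distinct , complete
    where
    cs : Fin m → Coloring p q 4
    cs i = model (ts i) (realisable i)

    distinct : ∀ i j → Equiv (cs i) (cs j) → i ≡ j
    distinct i j csᵢ~csⱼ = ts-injective (Equiv⇒sameTwist csᵢ~csⱼ
      (model-hasTwist (ts i) (realisable i)) (model-hasTwist (ts j) (realisable j)))

    complete : ∀ c → PerfectPrecise p q c → ∃ λ i → Equiv c (cs i)
    complete c perfectPrecise with classify c perfectPrecise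
    ... | t , realisable-t , c~t with ts-complete t realisable-t
    ...   | i , refl = i , sameTwist⇒Equiv c~t (model-hasTwist (ts i) (realisable i))

¬×⇒¬⊎¬ : ∀ {A B : Set} → Dec A → ¬ (A × B) → ¬ A ⊎ ¬ B
¬×⇒¬⊎¬ (yes a) ¬a×b = inj₂ λ b → ¬a×b (a , b)
¬×⇒¬⊎¬ (no ¬a) _    = inj₁ ¬a

¬⊎¬⇒¬× : ∀ {A B : Set} → ¬ A ⊎ ¬ B → ¬ (A × B)
¬⊎¬⇒¬× = [ (λ ¬a (a , _) → ¬a a) , (λ ¬b (_ , b) → ¬b b) ]

ExactlyOneRealisable : ℕ → ℕ → Set
ExactlyOneRealisable p q =
  (2 ∣ p × 2 ∣ q × (¬ 3 ∣ p ⊎ ¬ 3 ∣ q)) ⊎ (3 ∣ p × 3 ∣ q × (¬ 2 ∣ p ⊎ ¬ 2 ∣ q))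

realisableTwists-1⇔ : ∀ {p q} → RealisableTwists p q 1 ⇔ ExactlyOneRealisable p q
realisableTwists-1⇔ {p} {q} = mk⇔
  (λ (ts , realisable , _ , complete) → to (ts 0F) (realisable 0F) (λ t′ → only ∘ complete t′))
  from
  where
  only : ∀ {ts : Fin 1 → Twist} {t} → (∃ λ i → ts i ≡ t) → t ≡ ts 0F
  only (0F , ts₀≡t) = sym ts₀≡t

  to : ∀ t → Realisable t p q → (∀ t′ → Realisable t′ p q → t′ ≡ t) → ExactlyOneRealisable p q
  to untwisted (2∣p , 2∣q) unique =
    inj₁ (2∣p , 2∣q , ¬×⇒¬⊎¬ (3 ∣? p) λ r → contradiction (unique twisted r) λ ())
  to twisted   (3∣p , 3∣q) unique =
    inj₂ (3∣p , 3∣q , ¬×⇒¬⊎¬ (2 ∣? p) λ r → contradiction (unique untwisted r) λ ())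

  from : ExactlyOneRealisable p q → RealisableTwists p q 1
  from (inj₁ (2∣p , 2∣q , ¬3∣)) = (λ _ → untwisted) , (λ _ → 2∣p , 2∣q) , (λ { {0F} {0F} _ → refl })
    , λ { untwisted _ → 0F , refl ; twisted r → ⊥-elim (¬⊎¬⇒¬× ¬3∣ r) }
  from (inj₂ (3∣p , 3∣q , ¬2∣)) = (λ _ → twisted) , (λ _ → 3∣p , 3∣q) , (λ { {0F} {0F} _ → refl })
    , λ { untwisted r → ⊥-elim (¬⊎¬⇒¬× ¬2∣ r) ; twisted _ → 0F , refl }

realisableTwists-2⇔ : ∀ {p q} →
  RealisableTwists p q 2 ⇔ (Realisable untwisted p q × Realisable twisted p q)
realisableTwists-2⇔ {p} {q} = mk⇔ to from
  where
  to : RealisableTwists p q 2 → Realisable untwisted p q × Realisable twisted p q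
  to (ts , realisable , injective , _) with ts 0F in ts₀≡ | ts 1F in ts₁≡ | realisable 0F | realisable 1F
  ... | untwisted | twisted   | ρ₀ | ρ₁ = ρ₀ , ρ₁
  ... | twisted   | untwisted | ρ₀ | ρ₁ = ρ₁ , ρ₀
  ... | untwisted | untwisted | _  | _  = contradiction (injective (trans ts₀≡ (sym ts₁≡))) λ ()
  ... | twisted   | twisted   | _  | _  = contradiction (injective (trans ts₀≡ (sym ts₁≡))) λ ()

  from : Realisable untwisted p q × Realisable twisted p q → RealisableTwists p q 2
  from (ρᵤ , ρₜ) = ts , (λ { 0F → ρᵤ ; 1F → ρₜ }) , ts-injective
                 , λ { untwisted _ → 0F , refl ; twisted _ → 1F , refl }
    where
    ts : Fin 2 → Twist
    ts 0F = untwisted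
    ts 1F = twisted

    ts-injective : Injective _≡_ _≡_ ts
    ts-injective {0F} {0F} _ = refl
    ts-injective {1F} {1F} _ = refl
    ts-injective {0F} {1F} ()
    ts-injective {1F} {0F} ()

both-realisable⇔ : ∀ {p q} → (Realisable untwisted p q × Realisable twisted p q) ⇔ (6 ∣ p × 6 ∣ q)
both-realisable⇔ = mk⇔
  (λ ((2∣p , 2∣q) , (3∣p , 3∣q)) → lcm-least 2∣p 3∣p , lcm-least 2∣q 3∣q)
  (λ (6∣p , 6∣q) → (∣-trans (divides 3 refl) 6∣p , ∣-trans (divides 3 refl) 6∣q)
                 , (∣-trans (divides 2 refl) 6∣p , ∣-trans (divides 2 refl) 6∣q))

proposition2p1 : (p q : ℕ) → 3 ≤ p → 3 ≤ q →
    (NumPerfectPrecise p q 1 ⇔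
       ((2 ∣ p × 2 ∣ q × (¬ 3 ∣ p ⊎ ¬ 3 ∣ q))
        ⊎ (3 ∣ p × 3 ∣ q × (¬ 2 ∣ p ⊎ ¬ 2 ∣ q))))
    × (NumPerfectPrecise p q 2 ⇔ (6 ∣ p × 6 ∣ q))
-- The bounds 3 ≤ p, 3 ≤ q only make (p.q.p.q) a tiling; the count holds for all p and q.
proposition2p1 p q _ _ =
    ⇔-trans numPerfectPrecise⇔realisableTwists realisableTwists-1⇔
  , ⇔-trans numPerfectPrecise⇔realisableTwists (⇔-trans realisableTwists-2⇔ both-realisable⇔)
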